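{- Let $\mathcal{A}$ be a weakly acyclic DFA. Then the minimal DFA accepting the language $L(\mathcal{A})$ is also weakly acyclic.
   Context: For a word $w$, $\mathrm{alp}(w)$ is the set of letters occurring in $w$, and $\Sigma^+$ is the set of nonempty words over $\Sigma$. A DFA $(Q,\Sigma,\delta,q_0,F)$ is weakly acyclic if for every $q\in Q$, every $w\in\Sigma^+$ and every $a\in\mathrm{alp}(w)$, $\delta(q,w)=q$ implies $\delta(q,a)=q$ (equivalently, its state graph has no cycles other than self-loops). -}

module Defs where

open import Data.Nat using (ℕ; _≤_)
open import Data.Fin using (Fin)
open import Data.Bool using (Bool; true)
open import Data.List using (List; []; _∷_)
open import Data.List.Membership.Propositional using (_∈_)
open import Relation.Binary.PropositionalEquality using (_≡_; _≢_)

record DFA (k n : ℕ) : Set where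
  field
    δ  : Fin n → Fin k → Fin n
    q₀ : Fin n
    F  : Fin n → Bool

module _ {k n : ℕ} (A : DFA k n) where
  open DFA A

  δ* : Fin n → List (Fin k) → Fin n
  δ* q []      = q
  δ* q (a ∷ w) = δ* (δ q a) w

  Accepts : List (Fin k) → Set
  Accepts w = F (δ* q₀ w) ≡ true

  WeaklyAcyclic : Set
  WeaklyAcyclic = ∀ (q : Fin n) (w : List (Fin k)) → w ≢ [] →
    δ* q w ≡ q → ∀ (a : Fin k) → a ∈ w → δ q a ≡ q

SameLanguage : ∀ {k n m} → DFA k n → DFA k m → Set
SameLanguage {k} A B = ∀ (w : List (Fin k)) → F A (δ* A (q₀ A) w) ≡ F B (δ* B (q₀ B) w)
  where open DFA

IsMinimal : ∀ {k n} → DFA k n → Set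
IsMinimal {k} {n} A = ∀ (m : ℕ) (B : DFA k m) → SameLanguage A B → n ≤ m

{-# OPTIONS --safe #-}

-- A minimal DFA M has only reachable states, and no two distinct
-- states of M accept the same words (otherwise one could delete a state).
-- Let q --w--> q be a cycle of M, a ∈ w, and u a word leading to q.  Since A
-- is finite, the A-states reached by u wˣ repeat, and by weak acyclicity of A
-- the state p reached at the repetition is fixed by a.  The words u wˣ lead
-- M to q, so q and p accept the same words, and hence so do δ(q,a) and
-- δ(p,a) = p.  Thus q and δ(q,a) are equivalent, i.e. equal.
module Submission where

open import Defs
open import Data.Nat using (ℕ; zero; suc; _+_)
open import Data.Nat.Properties using (n<1+n; 1+n≰n; +-suc; m≤n⇒∃[o]m+o≡n)
open import Data.Fin using (Fin; toℕ; punchIn; punchOut; _≟_)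
open import Data.Fin.Properties using (punchIn-punchOut; pigeonhole)
open import Data.List using (List; []; _∷_; _++_; [_])
open import Data.List.Properties using (++-assoc; ++-conicalˡ)
open import Data.List.Membership.Propositional using (_∈_)
open import Data.List.Membership.Propositional.Properties using (∈-++⁺ˡ)
open import Data.Product using (∃; _×_; _,_)
open import Function using (_∘_)
open import Relation.Nullary using (¬_; yes; no)
open import Relation.Nullary.Decidable using (decidable-stable)
open import Relation.Nullary.Negation using (¬¬-map; contradiction)
open import Relation.Binary.PropositionalEquality
  using (_≡_; _≢_; refl; sym; trans; cong; subst; module ≡-Reasoning)

open DFA

private variable
  k n m : ℕ

Equivalent : DFA k n → Fin n → DFA k m → Fin m → Set
Equivalent {k} A p B q = ∀ (w : List (Fin k)) → F A (δ* A p w) ≡ F B (δ* B q w)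

Reachable : DFA k n → Fin n → Set
Reachable A p = ∃ λ u → δ* A (q₀ A) u ≡ p

_^_ : List (Fin k) → ℕ → List (Fin k)
w ^ zero  = []
w ^ suc x = w ++ w ^ x

^-+ : ∀ (w : List (Fin k)) x y → w ^ (x + y) ≡ w ^ x ++ w ^ y
^-+ w zero    y = refl
^-+ w (suc x) y = trans (cong (w ++_) (^-+ w x y)) (sym (++-assoc w (w ^ x) (w ^ y)))

δ*-++ : ∀ (A : DFA k n) p u v → δ* A p (u ++ v) ≡ δ* A (δ* A p u) v
δ*-++ A p []      v = refl
δ*-++ A p (a ∷ u) v = δ*-++ A (δ A p a) u v

δ*-^-+ : ∀ (A : DFA k n) p w x y → δ* A p (w ^ (x + y)) ≡ δ* A (δ* A p (w ^ x)) (w ^ y)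
δ*-^-+ A p w x y = trans (cong (δ* A p) (^-+ w x y)) (δ*-++ A p (w ^ x) (w ^ y))

δ*-^-cycle : ∀ (A : DFA k n) {p w} → δ* A p w ≡ p → ∀ x → δ* A p (w ^ x) ≡ p
δ*-^-cycle A         cyc zero    = refl
δ*-^-cycle A {p} {w} cyc (suc x) = begin
  δ* A p (w ++ w ^ x)     ≡⟨ δ*-++ A p w (w ^ x) ⟩
  δ* A (δ* A p w) (w ^ x) ≡⟨ cong (λ r → δ* A r (w ^ x)) cyc ⟩
  δ* A p (w ^ x)          ≡⟨ δ*-^-cycle A cyc x ⟩
  p                       ∎
  where open ≡-Reasoning

equivalent-δ* : ∀ (A : DFA k n) (B : DFA k m) {p q} →
  Equivalent A p B q → ∀ u → Equivalent A (δ* A p u) B (δ* B q u)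
equivalent-δ* A B {p} {q} p∼q u v = begin
  F A (δ* A (δ* A p u) v) ≡⟨ cong (F A) (sym (δ*-++ A p u v)) ⟩
  F A (δ* A p (u ++ v))   ≡⟨ p∼q (u ++ v) ⟩
  F B (δ* B q (u ++ v))   ≡⟨ cong (F B) (δ*-++ B q u v) ⟩
  F B (δ* B (δ* B q u) v) ∎
  where open ≡-Reasoning

bisimulation⇒equivalent : ∀ (A : DFA k n) (B : DFA k m) (R : Fin n → Fin m → Set) →
  (∀ {p q} → R p q → F A p ≡ F B q) →
  (∀ {p q} a → R p q → R (δ A p a) (δ B q a)) →
  ∀ {p q} → R p q → Equivalent A p B q
bisimulation⇒equivalent A B R accept step pRq []      = accept pRq
bisimulation⇒equivalent A B R accept step pRq (a ∷ w) =
  bisimulation⇒equivalent A B R accept step (step a pRq) w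

weaklyAcyclic⇒power-fixed : ∀ (A : DFA k n) → WeaklyAcyclic A →
  ∀ p {w} → w ≢ [] → ∃ λ x → ∀ {a} → a ∈ w → δ A (δ* A p (w ^ x)) a ≡ δ* A p (w ^ x)
weaklyAcyclic⇒power-fixed {n = n} A wa p {w} w≢[]
  with i , j , i<j , orbitᵢ≡orbitⱼ ← pigeonhole (n<1+n n) (λ i → δ* A p (w ^ toℕ i))
  with d , i+1+d≡j ← m≤n⇒∃[o]m+o≡n i<j
  = toℕ i , λ a∈w → wa r (w ^ suc d) (w≢[] ∘ ++-conicalˡ w (w ^ d)) loop _ (∈-++⁺ˡ a∈w)
  where
  open ≡-Reasoning
  r : Fin n
  r = δ* A p (w ^ toℕ i)

  loop : δ* A r (w ^ suc d) ≡ r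
  loop = begin
    δ* A r (w ^ suc d)               ≡⟨ sym (δ*-^-+ A p w (toℕ i) (suc d)) ⟩
    δ* A p (w ^ (toℕ i + suc d))     ≡⟨ cong (λ y → δ* A p (w ^ y)) (trans (+-suc (toℕ i) d) i+1+d≡j) ⟩
    δ* A p (w ^ toℕ j)               ≡⟨ sym orbitᵢ≡orbitⱼ ⟩
    r                                ∎

module Collapse (M : DFA k (suc m)) {s t : Fin (suc m)} (s≢t : s ≢ t) where

  redirect : Fin (suc m) → Fin (suc m)
  redirect x with x ≟ s
  ... | yes _ = t
  ... | no  _ = x

  redirect-≢ : ∀ {x} → x ≢ s → redirect x ≡ x
  redirect-≢ {x} x≢s with x ≟ s
  ... | yes x≡s = contradiction x≡s x≢s
  ... | no  _   = refl

  redirect-equivalent : Equivalent M s M t → ∀ x → Equivalent M x M (redirect x)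
  redirect-equivalent s∼t x with x ≟ s
  ... | yes refl = s∼t
  ... | no  _    = λ _ → refl

  s≢redirect : ∀ x → s ≢ redirect x
  s≢redirect x with x ≟ s
  ... | yes _   = s≢t
  ... | no  x≢s = x≢s ∘ sym

  collapsed : DFA k m
  collapsed = record
    { δ  = λ i a → punchOut (s≢redirect (δ M (punchIn s i) a))
    ; q₀ = punchOut (s≢redirect (q₀ M))
    ; F  = F M ∘ punchIn s
    }

  punchIn-δ : ∀ i a → punchIn s (δ collapsed i a) ≡ redirect (δ M (punchIn s i) a)
  punchIn-δ i a = punchIn-punchOut (s≢redirect (δ M (punchIn s i) a))

  punchIn-q₀ : punchIn s (q₀ collapsed) ≡ redirect (q₀ M)
  punchIn-q₀ = punchIn-punchOut (s≢redirect (q₀ M))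

  sameLanguage-if-equivalent : Equivalent M s M t → SameLanguage M collapsed
  sameLanguage-if-equivalent s∼t =
    bisimulation⇒equivalent M collapsed R (λ x∼i → x∼i []) step
      (subst (Equivalent M (q₀ M) M) (sym punchIn-q₀) (redirect-equivalent s∼t (q₀ M)))
    where
    R : Fin (suc m) → Fin m → Set
    R x i = Equivalent M x M (punchIn s i)

    step : ∀ {x i} a → R x i → R (δ M x a) (δ collapsed i a)
    step {x} {i} a x∼i v rewrite punchIn-δ i a =
      trans (x∼i (a ∷ v)) (redirect-equivalent s∼t (δ M (punchIn s i) a) v)

  sameLanguage-if-unreachable : ¬ Reachable M s → SameLanguage M collapsed
  sameLanguage-if-unreachable s-unreachable =
    bisimulation⇒equivalent M collapsed R (λ { (refl , _) → refl }) step
      (trans punchIn-q₀ (redirect-≢ (avoids [])) , avoids)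
    where
    avoids : ∀ u → δ* M (q₀ M) u ≢ s
    avoids u e = s-unreachable (u , e)

    R : Fin (suc m) → Fin m → Set
    R x i = punchIn s i ≡ x × (∀ u → δ* M x u ≢ s)

    step : ∀ {x i} a → R x i → R (δ M x a) (δ collapsed i a)
    step {i = i} a (refl , x-avoids) =
      trans (punchIn-δ i a) (redirect-≢ (x-avoids [ a ])) , x-avoids ∘ (a ∷_)

  not-minimal : IsMinimal M → ¬ SameLanguage M collapsed
  not-minimal minimal same = 1+n≰n (minimal m collapsed same)

minimal⇒reachable : ∀ (M : DFA k n) → IsMinimal M → ∀ p → ¬ ¬ Reachable M p
minimal⇒reachable {n = suc m} M minimal p p-unreachable =
  not-minimal minimal (sameLanguage-if-unreachable p-unreachable)
  where open Collapse M {p} {q₀ M} (λ p≡q₀ → p-unreachable ([] , sym p≡q₀))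

minimal⇒reduced : ∀ (M : DFA k n) → IsMinimal M → ∀ {s t} → Equivalent M s M t → s ≡ t
minimal⇒reduced {n = suc m} M minimal {s} {t} s∼t = decidable-stable (s ≟ t) λ s≢t →
  let open Collapse M s≢t in not-minimal minimal (sameLanguage-if-equivalent s∼t)

proposition2 : ∀ {k n : ℕ} (A : DFA k n) → WeaklyAcyclic A →
    ∀ {m : ℕ} (M : DFA k m) → SameLanguage A M → IsMinimal M → WeaklyAcyclic M
proposition2 {n = n} A wa M sameLanguage minimal q w w≢[] cyc a a∈w =
  decidable-stable (δ M q a ≟ q) (¬¬-map fixed (minimal⇒reachable M minimal q))
  where
  fixed : Reachable M q → δ M q a ≡ q
  fixed (u , u↦q)
    with x , a-fixes ← weaklyAcyclic⇒power-fixed A wa (δ* A (q₀ A) u) w≢[]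
    = sym (minimal⇒reduced M minimal (λ v → trans (sym (p∼q v)) (p∼qa v)))
    where
    pᵤ p : Fin n
    pᵤ = δ* A (q₀ A) u
    p  = δ* A pᵤ (w ^ x)

    pᵤ∼q : Equivalent A pᵤ M q
    pᵤ∼q = subst (Equivalent A pᵤ M) u↦q (equivalent-δ* A M sameLanguage u)

    p∼q : Equivalent A p M q
    p∼q = subst (Equivalent A p M) (δ*-^-cycle M cyc x) (equivalent-δ* A M pᵤ∼q (w ^ x))

    p∼qa : Equivalent A p M (δ M q a)
    p∼qa = subst (λ r → Equivalent A r M (δ M q a)) (a-fixes a∈w) (equivalent-δ* A M p∼q [ a ])
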